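{- Let $b$ and $k$ be nonnegative integers and let $p$ be an odd integer such that $$(2^{k+1}-1)(p^2+p+1) = 2^{k+1}p^2 + 2^b p + 1.$$ Then $p \mid 2^k - 1$ and $p + 1 \mid 2^b - 2$. -}

module Defs where

{-# OPTIONS --safe #-}
module Submission where

-- Write t = 2^k and B = 2^b. Expanding, the equation is equivalent to
-- 2(t - 1) = (p + 1 + B - 2t) p, and also to B - 2 = (B - 2t + p)(p + 1).
-- The second gives p + 1 ∣ 2^b - 2 at once; the first gives p ∣ 2(t - 1),
-- and since p is odd it is coprime to 2, so p ∣ 2^k - 1.

open import Defs
open import Data.Nat using (ℕ; suc)
open import Data.Integer using (ℤ; +_; _+_; _*_; _-_; _^_)
open import Data.Integer.Divisibility using (_∣_)
open import Data.Product using (_×_; _,_)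
open import Relation.Nullary using (¬_; contradiction)
open import Relation.Binary.PropositionalEquality using (_≡_; refl; trans; cong)

import Data.Nat.Divisibility as ℕ
open import Data.Nat.Coprimality using (Coprime)
open import Data.Nat.Primality using (irreducible[2])
open import Data.Integer.Properties using (+-inverseʳ; +-identityʳ)
open import Data.Integer.Coprimality using (coprime-divisor)
open import Data.Integer.Divisibility.Signed using (divides; ∣⇒∣ᵤ)
open import Data.Integer.Tactic.RingSolver using (solve-∀)
open import Data.Sum using (inj₁; inj₂)

odd⇒coprime-2 : ∀ {n} → ¬ (2 ℕ.∣ n) → Coprime n 2
odd⇒coprime-2 2∤n (d∣n , d∣2) with irreducible[2] d∣2
... | inj₁ d≡1 = d≡1
... | inj₂ refl = contradiction d∣n 2∤n

odd-∣2*⇒∣ : ∀ p x → ¬ (+ 2 ∣ p) → p ∣ + 2 * x → p ∣ x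
odd-∣2*⇒∣ p x 2∤p = coprime-divisor p (+ 2) x (odd⇒coprime-2 2∤p)

∣-by-quotient : ∀ {d n} q → n ≡ q * d → d ∣ n
∣-by-quotient q eq = ∣⇒∣ᵤ (divides q eq)

cancel-difference : ∀ {x y L R : ℤ} → x ≡ y + (L - R) → L ≡ R → x ≡ y
cancel-difference {y = y} {R = R} x≡y+[L-R] refl =
  trans x≡y+[L-R] (trans (cong (λ z → y + z) (+-inverseʳ R)) (+-identityʳ y))

Equation : ℤ → ℤ → ℤ → Set
Equation t B p = (+ 2 * t - + 1) * (p ^ 2 + p + + 1) ≡ + 2 * t * p ^ 2 + B * p + + 1

-- In the identities below p ^ 2 is written in its unfolded form p * (p * + 1),
-- which the ring solver accepts and which agrees definitionally with Equation.

equation⇒∣2[t-1] : ∀ t B p → Equation t B p → p ∣ + 2 * (t - + 1)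
equation⇒∣2[t-1] t B p eq = ∣-by-quotient (p + + 1 + B - + 2 * t) (cancel-difference (expand t B p) eq)
  where
  expand : ∀ t B p → + 2 * (t - + 1) ≡ (p + + 1 + B - + 2 * t) * p
    + ((+ 2 * t - + 1) * (p * (p * + 1) + p + + 1) - (+ 2 * t * (p * (p * + 1)) + B * p + + 1))
  expand = solve-∀

equation⇒[p+1]∣B-2 : ∀ t B p → Equation t B p → p + + 1 ∣ B - + 2
equation⇒[p+1]∣B-2 t B p eq = ∣-by-quotient (B - + 2 * t + p) (cancel-difference (expand t B p) eq)
  where
  expand : ∀ t B p → B - + 2 ≡ (B - + 2 * t + p) * (p + + 1)
    + ((+ 2 * t - + 1) * (p * (p * + 1) + p + + 1) - (+ 2 * t * (p * (p * + 1)) + B * p + + 1))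
  expand = solve-∀

lemma5 : (b k : ℕ) (p : ℤ) → ¬ (+ 2 ∣ p) →
    ((+ 2) ^ (suc k) - + 1) * (p ^ 2 + p + + 1) ≡ (+ 2) ^ (suc k) * p ^ 2 + (+ 2) ^ b * p + + 1 →
    (p ∣ (+ 2) ^ k - + 1) × (p + + 1 ∣ (+ 2) ^ b - + 2)
lemma5 b k p 2∤p eq =
  odd-∣2*⇒∣ p ((+ 2) ^ k - + 1) 2∤p (equation⇒∣2[t-1] ((+ 2) ^ k) ((+ 2) ^ b) p eq) ,
  equation⇒[p+1]∣B-2 ((+ 2) ^ k) ((+ 2) ^ b) p eq
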